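{- For all integers $n > k \geq 3$, \[ \operatorname{sz}(n, \lfloor k/2\rfloor) + 1 \leq \operatorname{aw}([n], k) - 1 \leq \operatorname{sz}(n,k). \]
   Context: $[n]=\{1,\dots,n\}$. A $k$-AP in a set of integers is a set of $k$ distinct elements $a,a+d,\dots,a+(k-1)d$ with $d\ge1$. $\operatorname{sz}(n,k)$ denotes the largest size of a set $S\subseteq[n]$ containing no $k$-AP. An $r$-coloring of $[n]$ is a map $[n]\to\{1,\dots,r\}$, exact if surjective; a $k$-AP is rainbow if its elements receive $k$ distinct colors. $\operatorname{aw}([n],k)$ is the smallest $r$ such that every exact $r$-coloring of $[n]$ contains a rainbow $k$-AP. -}

module Defs where

open import Data.Nat using (ℕ; _+_; _*_; _≤_; _<_)
open import Data.Fin using (Fin; toℕ)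
open import Data.Fin.Subset using (Subset; _∈_; ∣_∣)
open import Data.Product using (Σ; ∃; _×_)
open import Relation.Nullary using (¬_)
open import Relation.Binary.PropositionalEquality using (_≡_)
open import Function.Definitions using (Injective; Surjective)

-- The interval [n] = {1,…,n} is represented by Fin n: the element x : Fin n
-- stands for the integer toℕ x + 1.

HasAP : (n k : ℕ) → Subset n → Set
HasAP n k S =
  Σ ℕ λ a → Σ ℕ λ d → (1 ≤ d) ×
    ((j : ℕ) → j < k → Σ (Fin n) λ x → (toℕ x + 1 ≡ a + j * d) × (x ∈ S))

IsSz : (n k m : ℕ) → Set
IsSz n k m =
  (Σ (Subset n) λ S → (∣ S ∣ ≡ m) × ¬ HasAP n k S) ×
  ((S : Subset n) → ¬ HasAP n k S → ∣ S ∣ ≤ m)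

-- An r-coloring of [n]: colors {1,…,r} represented by Fin r.
-- A rainbow k-AP for c: a, d ≥ 1 and positions p j = a + j d (j < k) in [n]
-- whose colors are pairwise distinct.
HasRainbowAP : (n k r : ℕ) → (Fin n → Fin r) → Set
HasRainbowAP n k r c =
  Σ ℕ λ a → Σ ℕ λ d → (1 ≤ d) × Σ (Fin k → Fin n) λ p →
    ((j : Fin k) → toℕ (p j) + 1 ≡ a + toℕ j * d) ×
    Injective _≡_ _≡_ (λ j → c (p j))

EveryExactHasRainbow : (n k r : ℕ) → Set
EveryExactHasRainbow n k r =
  (c : Fin n → Fin r) → Surjective _≡_ _≡_ c → HasRainbowAP n k r c

IsAw : (n k r : ℕ) → Set
IsAw n k r =
  (1 ≤ r) × EveryExactHasRainbow n k r ×
  ((r' : ℕ) → 1 ≤ r' → EveryExactHasRainbow n k r' → r ≤ r')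

module Submission where

-- Upper bound, aw([n],k) ≤ sz(n,k) + 1: in an exact (sz(n,k)+1)-colouring pick
-- one representative of every colour.  These representatives form a set larger
-- than sz(n,k), hence containing a k-AP, and that k-AP is rainbow because
-- distinct representatives have distinct colours.
--
-- Lower bound, aw([n],k) ≥ sz(n,⌊k/2⌋) + 2: give the elements of a ⌊k/2⌋-AP-free
-- set S distinct colours (by their rank in S) and everything else one extra
-- colour.  A rainbow k-AP then has at most one term outside S, so ⌊k/2⌋
-- consecutive terms before or after that term form a ⌊k/2⌋-AP inside S.
-- Merging colours preserves the absence of rainbow APs, so no exact colouring
-- with at most |S|+1 colours is forced to contain a rainbow k-AP.

open import Defs
open import Data.Nat using (ℕ; zero; suc; _+_; _*_; _∸_; _⊓_; _≤_; _<_; _/_; z≤n; s≤s; s≤s⁻¹; >-nonZero; _≤?_; _<?_)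
  renaming (_≟_ to _≟ℕ_)
open import Data.Nat.Properties
open import Data.Nat.DivMod using (m/n≤m; m/n*n≤m)
open import Data.Bool using (true; false)
open import Data.Bool.Properties using (T-≡)
open import Data.Fin using (Fin; zero; suc; toℕ; fromℕ; fromℕ<; inject₁; inject≤)
open import Data.Fin.Properties using (toℕ<n; toℕ-fromℕ<; toℕ-injective; toℕ-inject≤; injective⇒≤; any?; all?; ¬∀⟶∃¬)
  renaming (_≟_ to _≟F_; suc-injective to Fin-suc-injective)
open import Data.Fin.Relation.Unary.Top using (view; ‵fromℕ; ‵inj₁)
open import Data.Fin.Subset using (Subset; _∈_; _∉_; ∣_∣)
open import Data.Fin.Subset.Properties using (_∈?_)
open import Data.Vec using (_∷_; here; there; tabulate)
open import Data.Vec.Properties using (lookup∘tabulate; lookup⇒[]=; []=⇒lookup)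
open import Data.Product using (Σ; ∃; _×_; _,_; proj₁; proj₂)
open import Data.Empty using (⊥-elim)
open import Function using (_∘_)
open import Function.Bundles using (Equivalence)
open import Function.Definitions using (Injective; Surjective)
open import Function.Consequences.Propositional using (strictlySurjective⇒surjective)
open import Function.Construct.Composition using (surjective)
open import Level using (0ℓ)
open import Relation.Nullary using (¬_; Dec; yes; no; contradiction)
open import Relation.Nullary.Decidable using (_×-dec_; ¬?; map′; isYes; isYes≗does; toWitness; dec-true)
open import Relation.Unary using (Pred; Decidable)
open import Relation.Binary.PropositionalEquality

rank : ∀ {n} (S : Subset n) (x : Fin n) → x ∈ S → Fin ∣ S ∣
rank (true ∷ S) zero here = zero
rank (true ∷ S) (suc x) (there x∈S) = suc (rank S x x∈S)
rank (false ∷ S) (suc x) (there x∈S) = rank S x x∈S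

rank-irrelevant : ∀ {n} (S : Subset n) {x} (p q : x ∈ S) → rank S x p ≡ rank S x q
rank-irrelevant (true ∷ S) here here = refl
rank-irrelevant (true ∷ S) (there p) (there q) = cong suc (rank-irrelevant S p q)
rank-irrelevant (false ∷ S) (there p) (there q) = rank-irrelevant S p q

rank-injective : ∀ {n} (S : Subset n) {x y} (x∈S : x ∈ S) (y∈S : y ∈ S) →
  rank S x x∈S ≡ rank S y y∈S → x ≡ y
rank-injective (true ∷ S) here here _ = refl
rank-injective (true ∷ S) (there x∈S) (there y∈S) eq =
  cong suc (rank-injective S x∈S y∈S (Fin-suc-injective eq))
rank-injective (false ∷ S) (there x∈S) (there y∈S) eq = cong suc (rank-injective S x∈S y∈S eq)

rank-surjective : ∀ {n} (S : Subset n) (i : Fin ∣ S ∣) → ∃ λ x → Σ (x ∈ S) λ x∈S → rank S x x∈S ≡ i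
rank-surjective (true ∷ S) zero = zero , here , refl
rank-surjective (true ∷ S) (suc i) with rank-surjective S i
... | x , x∈S , eq = suc x , there x∈S , cong suc eq
rank-surjective (false ∷ S) i with rank-surjective S i
... | x , x∈S , eq = suc x , there x∈S , eq

injection⇒≤∣∣ : ∀ {m n} (S : Subset n) (g : Fin m → Fin n) → (∀ i → g i ∈ S) →
  Injective _≡_ _≡_ g → m ≤ ∣ S ∣
injection⇒≤∣∣ S g g∈S g-injective =
  injective⇒≤ (λ eq → g-injective (rank-injective S (g∈S _) (g∈S _) eq))

select : ∀ {n} {P : Pred (Fin n) 0ℓ} → Decidable P → Subset n
select P? = tabulate (λ x → isYes (P? x))

∈-select⁺ : ∀ {n} {P : Pred (Fin n) 0ℓ} (P? : Decidable P) {x} → P x → x ∈ select P?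
∈-select⁺ P? {x} px = lookup⇒[]= x _ (trans (lookup∘tabulate _ x) (trans (isYes≗does (P? x)) (dec-true (P? x) px)))

∈-select⁻ : ∀ {n} {P : Pred (Fin n) 0ℓ} (P? : Decidable P) {x} → x ∈ select P? → P x
∈-select⁻ P? {x} x∈ = toWitness {a? = P? x}
  (Equivalence.from T-≡ (trans (sym (lookup∘tabulate _ x)) ([]=⇒lookup x∈)))

-- A k-AP in S with start and difference at most n: a search over a finite space.
BoundedAP : (n k : ℕ) → Subset n → Set
BoundedAP n k S = Σ (Fin (suc n)) λ a → Σ (Fin (suc n)) λ d → (1 ≤ toℕ d) ×
  ((j : Fin k) → Σ (Fin n) λ x → (toℕ x + 1 ≡ toℕ a + toℕ j * toℕ d) × (x ∈ S))

boundedAP? : ∀ n k (S : Subset n) → Dec (BoundedAP n k S)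
boundedAP? n k S = any? λ a → any? λ d → (1 ≤? toℕ d) ×-dec all? λ j →
  any? λ x → (toℕ x + 1 ≟ℕ toℕ a + toℕ j * toℕ d) ×-dec (x ∈? S)

boundedAP⇒HasAP : ∀ {n k S} → BoundedAP n k S → HasAP n k S
boundedAP⇒HasAP (a , d , 1≤d , term) = toℕ a , toℕ d , 1≤d , λ j j<k →
  let x , eq , x∈S = term (fromℕ< j<k)
  in x , trans eq (cong (λ i → toℕ a + i * toℕ d) (toℕ-fromℕ< j<k)) , x∈S

term≤n : ∀ {n t} (x : Fin n) → toℕ x + 1 ≡ t → t ≤ n
term≤n {n} x eq = subst (_≤ n) (trans (+-comm 1 (toℕ x)) eq) (toℕ<n x)

-- When k ≥ 2 the first two terms force a ≤ n and d ≤ n.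
HasAP⇒boundedAP : ∀ {n k S} → 2 ≤ k → HasAP n k S → BoundedAP n k S
HasAP⇒boundedAP {n} 2≤k (a , d , 1≤d , term) =
  fromℕ< (s≤s a≤n) , fromℕ< (s≤s d≤n) , subst (1 ≤_) (sym d-eq) 1≤d , λ j →
    let x , eq , x∈S = term (toℕ j) (toℕ<n j)
    in x , trans eq (sym (cong₂ (λ u v → u + toℕ j * v) a-eq d-eq)) , x∈S
  where
  a≤n : a ≤ n
  a≤n = subst (_≤ n) (+-identityʳ a) (term≤n _ (proj₁ (proj₂ (term 0 (≤-trans (s≤s z≤n) 2≤k)))))
  d≤n : d ≤ n
  d≤n = m+n≤o⇒n≤o a (subst (λ t → a + t ≤ n) (+-identityʳ d) (term≤n _ (proj₁ (proj₂ (term 1 2≤k)))))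
  a-eq : toℕ (fromℕ< (s≤s a≤n)) ≡ a
  a-eq = toℕ-fromℕ< (s≤s a≤n)
  d-eq : toℕ (fromℕ< (s≤s d≤n)) ≡ d
  d-eq = toℕ-fromℕ< (s≤s d≤n)

HasAP? : ∀ {n k} (S : Subset n) → 2 ≤ k → Dec (HasAP n k S)
HasAP? {n} {k} S 2≤k = map′ boundedAP⇒HasAP (HasAP⇒boundedAP 2≤k) (boundedAP? n k S)

Progression : (n k a d : ℕ) → (Fin k → Fin n) → Set
Progression n k a d p = (j : Fin k) → toℕ (p j) + 1 ≡ a + toℕ j * d

progression-injective : ∀ {n k a d p} → 1 ≤ d → Progression n k a d p → Injective _≡_ _≡_ p
progression-injective {a = a} {d} {p} 1≤d prog {i} {j} eq =
  toℕ-injective (*-cancelʳ-≡ (toℕ i) (toℕ j) d {{>-nonZero 1≤d}}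
    (+-cancelˡ-≡ a _ _ (trans (sym (prog i)) (trans (cong (λ x → toℕ x + 1) eq) (prog j)))))

subprogression : ∀ {n k h a d p} (S : Subset n) (o : ℕ) → 1 ≤ d → Progression n k a d p →
  o + h ≤ k → (∀ j → o ≤ toℕ j → toℕ j < o + h → p j ∈ S) → HasAP n h S
subprogression {k = k} {h} {a} {d} {p} S o 1≤d prog o+h≤k inS = a + o * d , d , 1≤d , λ i i<h →
  let j = fromℕ< (index<k i<h)
      j≡o+i = toℕ-fromℕ< (index<k i<h)
  in p j ,
     (begin
       toℕ (p j) + 1        ≡⟨ prog j ⟩
       a + toℕ j * d        ≡⟨ cong (λ t → a + t * d) j≡o+i ⟩
       a + (o + i) * d      ≡⟨ cong (a +_) (*-distribʳ-+ d o i) ⟩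
       a + (o * d + i * d)  ≡⟨ +-assoc a (o * d) (i * d) ⟨
       a + o * d + i * d    ∎) ,
     inS j (subst (o ≤_) (sym j≡o+i) (m≤m+n o i)) (subst (_< o + h) (sym j≡o+i) (+-monoʳ-< o i<h))
  where
  open ≡-Reasoning
  index<k : ∀ {i} → i < h → o + i < k
  index<k i<h = ≤-trans (+-monoʳ-< o i<h) o+h≤k

-- Among the indices 0, …, k-1 with 2h ≤ k, removing one index j₀ still leaves
-- h consecutive indices: those before j₀ or those after it.
consecutiveAvoiding : ∀ h k j₀ → h + h ≤ k →
  ∃ λ o → (o + h ≤ k) × (∀ i → o ≤ i → i < o + h → i ≢ j₀)
consecutiveAvoiding h k j₀ 2h≤k with h ≤? j₀
... | yes h≤j₀ = 0 , ≤-trans (m≤m+n h h) 2h≤k , λ { i _ i<h refl → <⇒≱ i<h h≤j₀ }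
... | no h≰j₀ = suc j₀ , ≤-trans (+-monoˡ-≤ h (≰⇒> h≰j₀)) 2h≤k , λ { i o≤i _ refl → n≮n i o≤i }

half+half≤ : ∀ k → k / 2 + k / 2 ≤ k
half+half≤ k = subst (_≤ k) (trans (*-comm (k / 2) 2) (cong (k / 2 +_) (+-identityʳ (k / 2)))) (m/n*n≤m k 2)

-- If every k-AP-free subset of [n] has at most s elements, every exact
-- (s+1)-colouring of [n] has a rainbow k-AP: the set of chosen representatives
-- of the colours is too large to be k-AP-free.
everyExactHasRainbow : ∀ n k s → 2 ≤ k → ((S : Subset n) → ¬ HasAP n k S → ∣ S ∣ ≤ s) →
  EveryExactHasRainbow n k (suc s)
everyExactHasRainbow n k s 2≤k maxSize c c-surjective = rainbowIn (HasAP? T 2≤k)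
  where
  rep : Fin (suc s) → Fin n
  rep y = proj₁ (c-surjective y)
  c∘rep : ∀ y → c (rep y) ≡ y
  c∘rep y = proj₂ (c-surjective y) refl

  T : Subset n
  T = select (λ x → rep (c x) ≟F x)
  rep∈T : ∀ y → rep y ∈ T
  rep∈T y = ∈-select⁺ (λ x → rep (c x) ≟F x) (cong rep (c∘rep y))
  coloursDistinctOnT : ∀ {x y} → x ∈ T → y ∈ T → c x ≡ c y → x ≡ y
  coloursDistinctOnT {x} {y} x∈T y∈T eq = begin
    x           ≡⟨ ∈-select⁻ (λ z → rep (c z) ≟F z) x∈T ⟨
    rep (c x)   ≡⟨ cong rep eq ⟩
    rep (c y)   ≡⟨ ∈-select⁻ (λ z → rep (c z) ≟F z) y∈T ⟩
    y           ∎
    where open ≡-Reasoning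
  large : s < ∣ T ∣
  large = injection⇒≤∣∣ T rep rep∈T (λ eq → trans (sym (c∘rep _)) (trans (cong c eq) (c∘rep _)))

  rainbowIn : Dec (HasAP n k T) → HasRainbowAP n k (suc s) c
  rainbowIn (no noAP) = contradiction (maxSize T noAP) (<⇒≱ large)
  rainbowIn (yes (a , d , 1≤d , term)) = a , d , 1≤d , p , prog , λ eq →
    progression-injective 1≤d prog (coloursDistinctOnT (p∈T _) (p∈T _) eq)
    where
    p : Fin k → Fin n
    p j = proj₁ (term (toℕ j) (toℕ<n j))
    prog : Progression n k a d p
    prog j = proj₁ (proj₂ (term (toℕ j) (toℕ<n j)))
    p∈T : ∀ j → p j ∈ T
    p∈T j = proj₂ (proj₂ (term (toℕ j) (toℕ<n j)))

rankColouring : ∀ {n} (S : Subset n) → Fin n → Fin (suc ∣ S ∣)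
rankColouring S x with x ∈? S
... | yes x∈S = inject₁ (rank S x x∈S)
... | no _ = fromℕ ∣ S ∣

rankColouring-inside : ∀ {n} (S : Subset n) {x} (x∈S : x ∈ S) → rankColouring S x ≡ inject₁ (rank S x x∈S)
rankColouring-inside S {x} x∈S with x ∈? S
... | yes p = cong inject₁ (rank-irrelevant S p x∈S)
... | no x∉S = contradiction x∈S x∉S

rankColouring-outside : ∀ {n} (S : Subset n) {x} → x ∉ S → rankColouring S x ≡ fromℕ ∣ S ∣
rankColouring-outside S {x} x∉S with x ∈? S
... | yes x∈S = contradiction x∈S x∉S
... | no _ = refl

rankColouring-surjective : ∀ {n} (S : Subset n) → (∃ λ z → z ∉ S) → Surjective _≡_ _≡_ (rankColouring S)
rankColouring-surjective S (z , z∉S) = strictlySurjective⇒surjective hit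
  where
  hit : ∀ y → ∃ λ x → rankColouring S x ≡ y
  hit y with view y
  ... | ‵fromℕ = z , rankColouring-outside S z∉S
  ... | ‵inj₁ {i = i} _ with rank-surjective S i
  ...   | x , x∈S , eq = x , trans (rankColouring-inside S x∈S) (cong inject₁ eq)

-- In a rainbow progression for the rank colouring, all terms but possibly
-- one (of index j₀) lie in S, since terms outside S share a colour.
atMostOneOutside : ∀ {n k} (S : Subset n) (p : Fin k → Fin n) →
  Injective _≡_ _≡_ (rankColouring S ∘ p) → ∃ λ j₀ → ∀ j → toℕ j ≢ j₀ → p j ∈ S
atMostOneOutside {k = k} S p rainbow with any? (λ j → ¬? (p j ∈? S))
... | no allInside = k , λ j _ → inside j
  where
  inside : ∀ j → p j ∈ S
  inside j with p j ∈? S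
  ... | yes p∈S = p∈S
  ... | no p∉S = ⊥-elim (allInside (j , p∉S))
... | yes (j₀ , pj₀∉S) = toℕ j₀ , inside
  where
  inside : ∀ j → toℕ j ≢ toℕ j₀ → p j ∈ S
  inside j j≢j₀ with p j ∈? S
  ... | yes p∈S = p∈S
  ... | no p∉S = contradiction
    (cong toℕ (rainbow (trans (rankColouring-outside S p∉S) (sym (rankColouring-outside S pj₀∉S)))))
    j≢j₀

rankColouring-noRainbow : ∀ {n k} (S : Subset n) → ¬ HasAP n (k / 2) S →
  ¬ HasRainbowAP n k (suc ∣ S ∣) (rankColouring S)
rankColouring-noRainbow {k = k} S noAP (a , d , 1≤d , p , prog , rainbow) =
  let j₀ , othersInside = atMostOneOutside S p rainbow
      o , o+h≤k , avoids = consecutiveAvoiding (k / 2) k j₀ (half+half≤ k)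
  in noAP (subprogression S o 1≤d prog o+h≤k (λ j o≤j j<o+h → othersInside j (avoids _ o≤j j<o+h)))

-- An h-AP-free subset of [n] with h ≤ n misses some element (else 1, …, h is an h-AP in it).
apFree⇒outsider : ∀ {n h} (S : Subset n) → h ≤ n → ¬ HasAP n h S → ∃ λ z → z ∉ S
apFree⇒outsider {n} {h} S h≤n noAP with all? (_∈? S)
... | no notAll = ¬∀⟶∃¬ n _ (_∈? S) notAll
... | yes all∈S = contradiction (1 , 1 , s≤s z≤n , initialSegment) noAP
  where
  initialSegment : (i : ℕ) → i < h → Σ (Fin n) λ x → (toℕ x + 1 ≡ 1 + i * 1) × (x ∈ S)
  initialSegment i i<h = fromℕ< (≤-trans i<h h≤n) ,
    trans (cong (_+ 1) (toℕ-fromℕ< (≤-trans i<h h≤n))) (trans (+-comm i 1) (cong suc (sym (*-identityʳ i)))) ,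
    all∈S _

NoRainbowColouring : (n k r : ℕ) → Set
NoRainbowColouring n k r = Σ (Fin n → Fin r) λ c → Surjective _≡_ _≡_ c × ¬ HasRainbowAP n k r c

halfAPFree⇒noRainbowColouring : ∀ {n k} (S : Subset n) → k / 2 ≤ n → ¬ HasAP n (k / 2) S →
  NoRainbowColouring n k (suc ∣ S ∣)
halfAPFree⇒noRainbowColouring S h≤n noAP =
  rankColouring S , rankColouring-surjective S (apFree⇒outsider S h≤n noAP) , rankColouring-noRainbow S noAP

merge : ∀ {n k r r'} (f : Fin r → Fin r') → Surjective _≡_ _≡_ f →
  NoRainbowColouring n k r → NoRainbowColouring n k r'
merge f f-surjective (c , c-surjective , noRainbow) =
  f ∘ c , surjective _≡_ _≡_ _≡_ c-surjective f-surjective ,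
  λ (a , d , 1≤d , p , prog , rainbow) → noRainbow (a , d , 1≤d , p , prog , λ eq → rainbow (cong f eq))

clamp : ∀ {s} m → Fin (suc s) → Fin (suc m)
clamp m x = fromℕ< (s≤s (m⊓n≤n (toℕ x) m))

clamp-surjective : ∀ {s m} → m ≤ s → Surjective _≡_ _≡_ (clamp {s} m)
clamp-surjective {m = m} m≤s = strictlySurjective⇒surjective λ y → inject≤ y (s≤s m≤s) , toℕ-injective (begin
  toℕ (clamp m (inject≤ y (s≤s m≤s)))  ≡⟨ toℕ-fromℕ< _ ⟩
  toℕ (inject≤ y (s≤s m≤s)) ⊓ m        ≡⟨ cong (_⊓ m) (toℕ-inject≤ y (s≤s m≤s)) ⟩
  toℕ y ⊓ m                            ≡⟨ m≤n⇒m⊓n≡m (s≤s⁻¹ (toℕ<n y)) ⟩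
  toℕ y                                ∎)
  where open ≡-Reasoning

forcingNeedsMoreColours : ∀ {n k s a} → NoRainbowColouring n k (suc s) → 1 ≤ a →
  EveryExactHasRainbow n k a → s + 1 ≤ a ∸ 1
forcingNeedsMoreColours {s = s} {a = suc a'} colouring _ everyRainbow with s <? a'
... | yes s<a' = subst (_≤ a') (+-comm 1 s) s<a'
... | no s≮a' =
  let c , c-surjective , noRainbow = merge (clamp a') (clamp-surjective (≮⇒≥ s≮a')) colouring
  in ⊥-elim (noRainbow (everyRainbow c c-surjective))

proposition2p7 : (n k : ℕ) → 3 ≤ k → k < n →
    (s₁ s₂ a : ℕ) → IsSz n (k / 2) s₁ → IsSz n k s₂ → IsAw n k a →
    (s₁ + 1 ≤ a ∸ 1) × (a ∸ 1 ≤ s₂)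
proposition2p7 n k 3≤k k<n s₁ s₂ a ((S₁ , ∣S₁∣≡s₁ , S₁-free) , _) (_ , maxSize) (1≤a , everyRainbow , minimal) =
  lower , upper
  where
  h≤n : k / 2 ≤ n
  h≤n = ≤-trans (m/n≤m k 2) (<⇒≤ k<n)
  lower : s₁ + 1 ≤ a ∸ 1
  lower = forcingNeedsMoreColours
    (subst (NoRainbowColouring n k ∘ suc) ∣S₁∣≡s₁ (halfAPFree⇒noRainbowColouring S₁ h≤n S₁-free))
    1≤a everyRainbow
  upper : a ∸ 1 ≤ s₂
  upper = ∸-monoˡ-≤ 1 (minimal (suc s₂) (s≤s z≤n)
    (everyExactHasRainbow n k s₂ (≤-trans (s≤s (s≤s z≤n)) 3≤k) maxSize))
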